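{- Let $(p,R)$ be a mesh pattern with $p\in\mathfrak{S}_k$. Fix a subset $G\subseteq G(p)$, and for each $g\in G$ let $s_g$ be a square, or a pair of adjacent squares, that is shadeable from $g$ (with respect to $(p,R)$). Let $S=\bigcup_{g\in G}s_g$. Then $(p,R)\asymp(p,R\cup S)$.
   Context: A mesh pattern is a pair $(p,R)$ where $p\in\mathfrak{S}_k$ and $R\subseteq\{0,\dots,k\}^2$, where $(a,b)\in R$ denotes the unit square $[a,a+1]\times[b,b+1]$ in $[0,k+1]^2$; $G(p)=\{(i,p(i)):i\in[1,k]\}$. A permutation $w\in\mathfrak{S}_n$ contains $(p,R)$ if there are indices $1\le i_1<\dots<i_k\le n$ with $w(i_1)\cdots w(i_k)$ order isomorphic to $p$ such that, setting $i_0=0$, $i_{k+1}=n+1$, $v_0=0$, $v_{k+1}=n+1$ and $v_b=w(i_{p^{ -1}(b)})$ for $b\in[1,k]$, for every $(a,b)\in R$ the open rectangle $(i_a,i_{a+1})\times(v_b,v_{b+1})$ contains no point $(x,w(x))$. Mesh patterns $\pi,\sigma$ are coincident, $\pi\asymp\sigma$, if they are avoided by exactly the same permutations (of all sizes). Shadeability. Let $g=(i,j)\in G(p)$ (so $j=p(i)$). The four squares incident to $g$ are $(a,b)$ with $a\in\{i-1,i\}$, $b\in\{j-1,j\}$. For such $a,b$ write $a'$ for the other element of $\{i-1,i\}$ and $b'$ for the other element of $\{j-1,j\}$. (Single square.) A square $(a,b)$ incident to $g$ with $(a,b)\notin R$ is shadeable from $g$ if: $(a',b')\notin R$; at most one of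 $(a,b')$ and $(a',b)$ is in $R$; for all $x\notin\{i-1,i\}$, $(x,b')\in R$ implies $(x,b)\in R$; and for all $y\notin\{j-1,j\}$, $(a',y)\in R$ implies $(a,y)\in R$. (Vertical pair.) For $a\in\{i-1,i\}$, the pair $\{(a,j-1),(a,j)\}$ is shadeable from $g$ if none of the four squares incident to $g$ is in $R$; for all $x$, $(x,j-1)\in R$ if and only if $(x,j)\in R$; and for all $y$, $(a',y)\in R$ implies $(a,y)\in R$. (Horizontal pair.) For $b\in\{j-1,j\}$, the pair $\{(i-1,b),(i,b)\}$ is shadeable from $g$ if none of the four squares incident to $g$ is in $R$; for all $y$, $(i-1,y)\in R$ if and only if $(i,y)\in R$; and for all $x$, $(x,b')\in R$ implies $(x,b)\in R$. -}

module Defs where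

open import Data.Nat using (ℕ; zero; suc; _<_)
open import Data.Fin as F using (Fin; zero; suc; toℕ; inject₁)
open import Data.Fin.Properties using (_≟_)
open import Data.Fin.Permutation using (Permutation′; _⟨$⟩ʳ_; _⟨$⟩ˡ_)
open import Data.Bool using (Bool; true; false; _∨_; _∧_; not)
open import Data.Product using (Σ; ∃; _×_; _,_)
open import Data.Sum using (_⊎_)
open import Function using (_∘_; _⇔_)
open import Relation.Nullary using (¬_; ⌊_⌋)
open import Relation.Binary.PropositionalEquality using (_≡_; _≢_)

-- A permutation of size k is a bijection Fin k ↔ Fin k
-- (0-indexed: the paper's value/position m corresponds to Fin index m-1).
-- The shading R ⊆ {0,…,k}² is a Boolean matrix on Fin (suc k) × Fin (suc k);
-- (a , b) ∈ R  iff  R a b ≡ true.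

record MeshPattern : Set where
  constructor mesh
  field
    size : ℕ
    perm : Permutation′ size
    shade : Fin (suc size) → Fin (suc size) → Bool

open MeshPattern public

-- Given the (1-indexed) coordinates f : Fin k → ℕ of the k
-- chosen points (f a = coordinate number a+1) and the outer value `top`
-- (= n+1), for a square index a ∈ {0,…,k}:
--   lo f a      = c_a       (with c_0 = 0)
--   hi f top a  = c_{a+1}   (with c_{k+1} = top)
lo : ∀ {k} → (Fin k → ℕ) → Fin (suc k) → ℕ
lo f zero = 0
lo f (suc a) = f a

hi : ∀ {k} → (Fin k → ℕ) → ℕ → Fin (suc k) → ℕ
hi {zero} f top zero = top
hi {suc k} f top zero = f zero
hi {suc k} f top (suc a) = hi (f ∘ suc) top a

pos : ∀ {n} → Fin n → ℕ
pos x = suc (toℕ x)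

module _ {n : ℕ} (w : Permutation′ n) (P : MeshPattern) where
  private
    k = size P
    p = perm P
    R = shade P

  Increasing : (Fin k → Fin n) → Set
  Increasing ι = ∀ a b → a F.< b → ι a F.< ι b

  OrderIso : (Fin k → Fin n) → Set
  OrderIso ι = ∀ a b → ((w ⟨$⟩ʳ ι a) F.< (w ⟨$⟩ʳ ι b)) ⇔ ((p ⟨$⟩ʳ a) F.< (p ⟨$⟩ʳ b))

  iPos : (Fin k → Fin n) → Fin k → ℕ
  iPos ι a = pos (ι a)

  -- v_b = w(i_{p^{-1}(b)}) for b ∈ [1,k] (index b-1 in Fin k)
  vVal : (Fin k → Fin n) → Fin k → ℕ
  vVal ι c = pos (w ⟨$⟩ʳ ι (p ⟨$⟩ˡ c))

  EmptyBox : (Fin k → Fin n) → Fin (suc k) → Fin (suc k) → Set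
  EmptyBox ι a b = ∀ (x : Fin n) →
    ¬ ( (lo (iPos ι) a < pos x) × (pos x < hi (iPos ι) (suc n) a)
      × (lo (vVal ι) b < pos (w ⟨$⟩ʳ x)) × (pos (w ⟨$⟩ʳ x) < hi (vVal ι) (suc n) b))

  Occurrence : (Fin k → Fin n) → Set
  Occurrence ι = Increasing ι × OrderIso ι
               × (∀ a b → R a b ≡ true → EmptyBox ι a b)

Contains : ∀ {n} → Permutation′ n → MeshPattern → Set
Contains w P = ∃ λ ι → Occurrence w P ι

Avoids : ∀ {n} → Permutation′ n → MeshPattern → Set
Avoids w P = ¬ Contains w P

_≍_ : MeshPattern → MeshPattern → Set
π ≍ σ = ∀ (n : ℕ) (w : Permutation′ n) → Avoids w π ⇔ Avoids w σ

-- Shadings incident to a point g = (i , p(i)) of G(p), i ∈ [1,k]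
-- (here the Fin index i₀ = i-1).  Columns: col false = i-1, col true = i;
-- rows: row false = j-1, row true = j, where j = p(i).

module _ (P : MeshPattern) (i₀ : Fin (size P)) where
  private
    k = size P
    p = perm P
    R = shade P
    InR : Fin (suc k) → Fin (suc k) → Set
    InR a b = R a b ≡ true

  col : Bool → Fin (suc k)
  col false = inject₁ i₀
  col true = suc i₀

  row : Bool → Fin (suc k)
  row false = inject₁ (p ⟨$⟩ʳ i₀)
  row true = suc (p ⟨$⟩ʳ i₀)

  NoneIncident : Set
  NoneIncident = ∀ h v → ¬ InR (col h) (row v)

  -- single square (col h , row v); a' = col (not h), b' = row (not v)
  ShadeableSingle : Bool → Bool → Set
  ShadeableSingle h v =
      ¬ InR (col h) (row v)
    × ¬ InR (col (not h)) (row (not v))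
    × ¬ (InR (col h) (row (not v)) × InR (col (not h)) (row v))
    × (∀ x → x ≢ col false → x ≢ col true → InR x (row (not v)) → InR x (row v))
    × (∀ y → y ≢ row false → y ≢ row true → InR (col (not h)) y → InR (col h) y)

  -- vertical pair {(a,j-1),(a,j)} with a = col h
  ShadeableVertical : Bool → Set
  ShadeableVertical h =
      NoneIncident
    × (∀ x → (InR x (row false) → InR x (row true)) × (InR x (row true) → InR x (row false)))
    × (∀ y → InR (col (not h)) y → InR (col h) y)

  -- horizontal pair {(i-1,b),(i,b)} with b = row v
  ShadeableHorizontal : Bool → Set
  ShadeableHorizontal v =
      NoneIncident
    × (∀ y → (InR (col false) y → InR (col true) y) × (InR (col true) y → InR (col false) y))
    × (∀ x → InR x (row (not v)) → InR x (row v))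

data Shading : Set where
  single     : (h v : Bool) → Shading
  vertical   : (h : Bool) → Shading
  horizontal : (v : Bool) → Shading

Shadeable : (P : MeshPattern) → Fin (size P) → Shading → Set
Shadeable P i (single h v) = ShadeableSingle P i h v
Shadeable P i (vertical h) = ShadeableVertical P i h
Shadeable P i (horizontal v) = ShadeableHorizontal P i v

squares : (P : MeshPattern) → Fin (size P) → Shading →
          Fin (suc (size P)) → Fin (suc (size P)) → Bool
squares P i (single h v) x y = ⌊ x ≟ col P i h ⌋ ∧ ⌊ y ≟ row P i v ⌋
squares P i (vertical h) x y =
  ⌊ x ≟ col P i h ⌋ ∧ (⌊ y ≟ row P i false ⌋ ∨ ⌊ y ≟ row P i true ⌋)
squares P i (horizontal v) x y =
  (⌊ x ≟ col P i false ⌋ ∨ ⌊ x ≟ col P i true ⌋) ∧ ⌊ y ≟ row P i v ⌋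

anyFin : ∀ {k} → (Fin k → Bool) → Bool
anyFin {zero} f = false
anyFin {suc k} f = f zero ∨ anyFin (f ∘ suc)

-- S = ⋃_{g ∈ G} s_g, where G ⊆ G(p) is given by a Boolean mask on [1,k]
unionShading : (P : MeshPattern) → (Fin (size P) → Bool) → (Fin (size P) → Shading) →
               Fin (suc (size P)) → Fin (suc (size P)) → Bool
unionShading P G s x y = anyFin (λ i → G i ∧ squares P i (s i) x y)

addShading : (P : MeshPattern) → (Fin (size P) → Bool) → (Fin (size P) → Shading) → MeshPattern
addShading P G s = mesh (size P) (perm P) (λ x y → shade P x y ∨ unionShading P G s x y)

module Submission where

-- An occurrence of (p , R ∪ S) is one of (p , R), so the work is the converse.
-- Given an occurrence ι of (p , R) in which a square of some s_g contains a
-- point z of w, z lies in a square of ι incident to g, and we relocate g to a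
-- well chosen point q of that square.  The relocation lemma gives conditions
-- under which this yields again an occurrence of (p , R); the shadeability
-- conditions supply them.  q is chosen so that the measure μ (the sum over
-- g ∈ G of the distance of g from the far side of s_g) decreases, and
-- well-founded induction on μ ends at an occurrence of (p , R ∪ S).

open import Defs
open import Data.Nat as N using (ℕ; zero; suc; _<_; _≤_; z≤n; s≤s; _∸_; _+_)
open import Data.Nat.Properties as NP
  using (≤-trans; <-trans; ≤-<-trans; <-≤-trans; <⇒≤; <-irrefl; <-asym; <-cmp; ≤-refl; ≤-pred; _<?_)
open import Data.Nat.Induction using (<-wellFounded)
open import Data.Fin as F using (Fin; zero; suc; toℕ; inject₁)
open import Data.Fin.Properties as FP using (_≟_; toℕ-injective; toℕ-inject₁; toℕ<n; any?)
open import Data.Fin.Permutation using (Permutation′; _⟨$⟩ʳ_; _⟨$⟩ˡ_; inverseˡ; inverseʳ)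
open import Data.Vec.Functional using (updateAt)
open import Data.Vec.Functional.Properties using (updateAt-updates; updateAt-minimal)
open import Data.Bool using (Bool; true; false; _∨_; _∧_; not; if_then_else_)
import Data.Bool.Properties as BP
open import Data.Product using (Σ; ∃; _×_; _,_; proj₁; proj₂)
open import Data.Sum using (_⊎_; inj₁; inj₂; [_,_])
open import Data.Empty using (⊥; ⊥-elim)
open import Function using (_∘_; _⇔_; mk⇔; Equivalence; Injection; const; id)
open import Function.Properties.Inverse using (↔⇒↣)
open import Induction.WellFounded using (Acc; acc)
open import Relation.Nullary using (¬_; Dec; yes; no; ⌊_⌋)
open import Relation.Nullary.Decidable using (_×-dec_)
open import Relation.Binary using (tri<; tri≈; tri>)
open import Relation.Binary.PropositionalEquality
  using (_≡_; _≢_; refl; sym; trans; cong; subst; subst₂)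

StrictlyIncreasing : ∀ {k} → (Fin k → ℕ) → Set
StrictlyIncreasing f = ∀ s t → toℕ s < toℕ t → f s < f t

hi-cases : ∀ {k} (f : Fin k → ℕ) top (a : Fin (suc k)) →
  (toℕ a ≡ k × hi f top a ≡ top) ⊎ Σ (Fin k) (λ i → toℕ i ≡ toℕ a × hi f top a ≡ f i)
hi-cases {zero} f top zero = inj₁ (refl , refl)
hi-cases {suc k} f top zero = inj₂ (zero , refl , refl)
hi-cases {suc k} f top (suc a) with hi-cases (f ∘ suc) top a
... | inj₁ (e , h) = inj₁ (cong suc e , h)
... | inj₂ (i , e , h) = inj₂ (suc i , cong suc e , h)

increasing⇒monotone : ∀ {k} {f : Fin k → ℕ} → StrictlyIncreasing f →
  ∀ s t → toℕ s ≤ toℕ t → f s ≤ f t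
increasing⇒monotone inc s t le with NP.m≤n⇒m<n∨m≡n le
... | inj₁ lt = <⇒≤ (inc s t lt)
... | inj₂ eq rewrite toℕ-injective eq = ≤-refl

hi-inject₁ : ∀ {k} (f : Fin k → ℕ) top (i : Fin k) → hi f top (inject₁ i) ≡ f i
hi-inject₁ f top i with hi-cases f top (inject₁ i)
... | inj₁ (e , _) = ⊥-elim (FP.toℕ-inject₁-≢ i (sym e))
... | inj₂ (i' , e , h) rewrite toℕ-injective (trans e (toℕ-inject₁ i)) = h

hi≤line : ∀ {k} {f : Fin k → ℕ} top → StrictlyIncreasing f →
  ∀ a t → toℕ a ≤ toℕ t → hi f top a ≤ f t
hi≤line {f = f} top inc a t le with hi-cases f top a
... | inj₁ (e , _) = ⊥-elim (<-irrefl refl (≤-<-trans (subst (_≤ toℕ t) e le) (toℕ<n t)))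
... | inj₂ (i , e , h) rewrite h = increasing⇒monotone inc i t (subst (_≤ toℕ t) (sym e) le)

line≤lo : ∀ {k} {f : Fin k → ℕ} → StrictlyIncreasing f →
  ∀ a t → toℕ t < toℕ a → f t ≤ lo f a
line≤lo inc (suc a) t (s≤s le) = increasing⇒monotone inc t a le

line∉square : ∀ {k} {f : Fin k → ℕ} top → StrictlyIncreasing f →
  ∀ a t → lo f a < f t → f t < hi f top a → ⊥
line∉square top inc a t above below with <-cmp (toℕ t) (toℕ a)
... | tri< lt _ _ = <-irrefl refl (≤-<-trans (line≤lo inc a t lt) above)
... | tri≈ _ eq _ = <-irrefl refl (≤-<-trans (hi≤line top inc a t (NP.≤-reflexive (sym eq))) below)
... | tri> _ _ gt = <-irrefl refl (≤-<-trans (hi≤line top inc a t (<⇒≤ gt)) below)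

line<hi-above : ∀ {k} {f : Fin k → ℕ} top → StrictlyIncreasing f → (∀ t → f t < top) →
  ∀ i → f i < hi f top (suc i)
line<hi-above {f = f} top inc bounded i with hi-cases f top (suc i)
... | inj₁ (_ , h) rewrite h = bounded i
... | inj₂ (i' , e , h) rewrite h = inc i i' (subst (toℕ i <_) (sym e) ≤-refl)

lo-below<line : ∀ {k} {f : Fin k → ℕ} → StrictlyIncreasing f → (∀ t → 0 < f t) →
  ∀ i → lo f (inject₁ i) < f i
lo-below<line inc positive zero = positive zero
lo-below<line inc positive (suc i) = inc (inject₁ i) (suc i) (s≤s (NP.≤-reflexive (toℕ-inject₁ i)))

lo-unchanged : ∀ {k} (f f' : Fin k → ℕ) m → (∀ i → i ≢ m → f' i ≡ f i) →
  ∀ a → a ≢ suc m → lo f' a ≡ lo f a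
lo-unchanged f f' m same zero _ = refl
lo-unchanged f f' m same (suc a) ne = same a (ne ∘ cong suc)

hi-unchanged : ∀ {k} (f f' : Fin k → ℕ) top m → (∀ i → i ≢ m → f' i ≡ f i) →
  ∀ a → a ≢ inject₁ m → hi f' top a ≡ hi f top a
hi-unchanged f f' top m same a ne with hi-cases f top a | hi-cases f' top a
... | inj₁ (_ , h) | inj₁ (_ , h') = trans h' (sym h)
... | inj₁ (e , _) | inj₂ (i , e' , _) = ⊥-elim (<-irrefl refl (subst (_< _) (trans e' e) (toℕ<n i)))
... | inj₂ (i , e , _) | inj₁ (e' , _) = ⊥-elim (<-irrefl refl (subst (_< _) (trans e e') (toℕ<n i)))
... | inj₂ (i , e , h) | inj₂ (i' , e' , h') rewrite toℕ-injective (trans e' (sym e)) =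
  trans h' (trans (same i i≢m) (sym h))
  where
  i≢m : i ≢ m
  i≢m refl = ne (toℕ-injective (trans (sym e) (sym (toℕ-inject₁ i))))

Side : Bool → ℕ → ℕ → Set
Side true x c = c < x
Side false x c = x < c

Strip : (Bool → ℕ) → Bool → ℕ → ℕ → Set
Strip O h c x = Side h x c × Side (not h) x (O h)

Inside : (Bool → ℕ) → ℕ → Set
Inside O x = O false < x × x < O true

side? : ∀ h x c → Dec (Side h x c)
side? true x c = c <? x
side? false x c = x <? c

strip? : ∀ O h c x → Dec (Strip O h c x)
strip? O h c x = side? h x c ×-dec side? (not h) x (O h)

sideOf : ∀ x c → x ≢ c → Σ Bool λ h → Side h x c
sideOf x c ne with <-cmp x c
... | tri< lt _ _ = false , lt
... | tri≈ _ e _ = ⊥-elim (ne e)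
... | tri> _ _ gt = true , gt

opposite-sides : ∀ hq h₁ {q c} → Side hq q c → Side h₁ c q → not hq ≡ h₁
opposite-sides true true qc cq = ⊥-elim (<-asym qc cq)
opposite-sides true false _ _ = refl
opposite-sides false true _ _ = refl
opposite-sides false false qc cq = ⊥-elim (<-asym qc cq)

side-beyond : ∀ hq h₁ h₀ {q z c} → Side hq q c → Side h₁ z q → Side h₀ z c →
  h₀ ≡ h₁ ⊎ (h₀ ≡ hq × not hq ≡ h₁)
side-beyond _ true true _ _ _ = inj₁ refl
side-beyond _ false false _ _ _ = inj₁ refl
side-beyond true true false qc zq zc = ⊥-elim (<-asym (<-trans qc zq) zc)
side-beyond false true false _ _ _ = inj₂ (refl , refl)
side-beyond true false true _ _ _ = inj₂ (refl , refl)
side-beyond false false true qc zq zc = ⊥-elim (<-asym (<-trans zq qc) zc)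

stripInside : ∀ O h c x → Inside O c → Strip O h c x → Inside O x
stripInside O true c x (i₁ , i₂) (s₁ , s₂) = <-trans i₁ s₁ , s₂
stripInside O false c x (i₁ , i₂) (s₁ , s₂) = s₂ , <-trans s₁ i₂

insideStrip : ∀ O h c x → Inside O x → Side h x c → Strip O h c x
insideStrip O true c x (i₁ , i₂) s = s , i₂
insideStrip O false c x (i₁ , i₂) s = s , i₁

strip-beyond : ∀ O hq h₁ h₀ c q x → Inside O c → Strip O hq c q → Strip O h₁ q x →
  Side h₀ x c → Strip O h₀ c x
strip-beyond O hq h₁ h₀ c q x cIn qs xs =
  insideStrip O h₀ c x (stripInside O h₁ q x (stripInside O hq c q cIn qs) xs)

Adjacent : ∀ {k} → Fin k → (Bool → Fin (suc k)) → Set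
Adjacent m c = c false ≡ inject₁ m × c true ≡ suc m

Out : ∀ {k} → (Fin k → ℕ) → ℕ → Fin k → Bool → ℕ
Out f top m false = lo f (inject₁ m)
Out f top m true = hi f top (suc m)

InSquare : ∀ {k} → (Fin k → ℕ) → ℕ → Fin (suc k) → ℕ → Set
InSquare f top a x = lo f a < x × x < hi f top a

strip⇔square : ∀ {k} (f : Fin k → ℕ) top m c → Adjacent m c → ∀ h x →
  Strip (Out f top m) h (f m) x ⇔ InSquare f top (c h) x
strip⇔square f top m c (c₀ , c₁) false x rewrite c₀ | hi-inject₁ f top m =
  mk⇔ (λ (s₁ , s₂) → s₂ , s₁) (λ (s₁ , s₂) → s₂ , s₁)
strip⇔square f top m c (c₀ , c₁) true x rewrite c₁ = mk⇔ id id

inject₁≢suc : ∀ {k} (m : Fin k) → inject₁ m ≢ suc m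
inject₁≢suc m e = <-irrefl (trans (sym (toℕ-inject₁ m)) (cong toℕ e)) ≤-refl

movedLine-square : ∀ {k} (f f' : Fin k → ℕ) top m c → Adjacent m c →
  (∀ i → i ≢ m → f' i ≡ f i) → ∀ a x → InSquare f' top a x →
  (Σ Bool λ h → a ≡ c h × Strip (Out f top m) h (f' m) x)
  ⊎ (a ≢ c false × a ≢ c true × InSquare f top a x)
movedLine-square f f' top m c (c₀ , c₁) same a x (l , u) with a ≟ inject₁ m
... | yes refl rewrite lo-unchanged f f' m same (inject₁ m) (inject₁≢suc m) | hi-inject₁ f' top m =
  inj₁ (false , sym c₀ , u , l)
... | no a≢below with a ≟ suc m
...   | yes refl rewrite hi-unchanged f f' top m same (suc m) (inject₁≢suc m ∘ sym) =
  inj₁ (true , sym c₁ , l , u)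
...   | no a≢above rewrite lo-unchanged f f' m same a a≢above | hi-unchanged f f' top m same a a≢below =
  inj₂ ((λ e → a≢below (trans e c₀)) , (λ e → a≢above (trans e c₁)) , l , u)

line-inside : ∀ {k} {f : Fin k → ℕ} top → StrictlyIncreasing f → (∀ t → f t < top) →
  (∀ t → 0 < f t) → ∀ m → Inside (Out f top m) (f m)
line-inside top inc bounded positive m = lo-below<line inc positive m , line<hi-above top inc bounded m

dec-true : ∀ {A : Set} (d : Dec A) → ⌊ d ⌋ ≡ true → A
dec-true (yes a) _ = a

∧-split : ∀ {a b} → a ∧ b ≡ true → a ≡ true × b ≡ true
∧-split {true} {true} _ = refl , refl

∨-split : ∀ {a b} → a ∨ b ≡ true → a ≡ true ⊎ b ≡ true
∨-split {true} _ = inj₁ refl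
∨-split {false} e = inj₂ e

bool-cases : ∀ h h' → h' ≡ h ⊎ h' ≡ not h
bool-cases true true = inj₁ refl
bool-cases true false = inj₂ refl
bool-cases false true = inj₂ refl
bool-cases false false = inj₁ refl

anyFin-true : ∀ {k} (f : Fin k → Bool) → anyFin f ≡ true → ∃ λ i → f i ≡ true
anyFin-true {suc k} f e with ∨-split {f zero} e
... | inj₁ e' = zero , e'
... | inj₂ e' with anyFin-true (f ∘ suc) e'
...   | (i , e'') = suc i , e''

sumFin : ∀ {k} → (Fin k → ℕ) → ℕ
sumFin {zero} f = 0
sumFin {suc k} f = f zero + sumFin (f ∘ suc)

sumFin-cong : ∀ {k} (f g : Fin k → ℕ) → (∀ i → f i ≡ g i) → sumFin f ≡ sumFin g
sumFin-cong {zero} f g e = refl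
sumFin-cong {suc k} f g e rewrite e zero | sumFin-cong (f ∘ suc) (g ∘ suc) (e ∘ suc) = refl

sumFin-< : ∀ {k} (f g : Fin k → ℕ) i₀ → (∀ i → i ≢ i₀ → f i ≡ g i) → f i₀ < g i₀ →
  sumFin f < sumFin g
sumFin-< f g zero e lt =
  NP.+-mono-<-≤ lt (NP.≤-reflexive (sumFin-cong (f ∘ suc) (g ∘ suc) (λ i → e (suc i) (λ ()))))
sumFin-< f g (suc i₀) e lt rewrite e zero (λ ()) =
  NP.+-mono-≤-< (≤-refl {g zero})
    (sumFin-< (f ∘ suc) (g ∘ suc) i₀ (λ i ne → e (suc i) (ne ∘ FP.suc-injective)) lt)

-- Nearer h a b: within a strip on side h of some centre, a is at least as
-- near to the centre as b.
Nearer : Bool → ℕ → ℕ → Set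
Nearer true a b = a ≤ b
Nearer false a b = b ≤ a

Nearer-refl : ∀ h a → Nearer h a a
Nearer-refl true a = ≤-refl
Nearer-refl false a = ≤-refl

Nearer-trans : ∀ h {a b c} → Nearer h a b → Nearer h b c → Nearer h a c
Nearer-trans true ab bc = ≤-trans ab bc
Nearer-trans false ab bc = ≤-trans bc ab

Nearer-total : ∀ h a b → Nearer h a b ⊎ Nearer h b a
Nearer-total true a b = NP.≤-total a b
Nearer-total false a b = NP.≤-total b a

Nearer⇒¬Side : ∀ h a b → Nearer h a b → ¬ Side (not h) b a
Nearer⇒¬Side true a b le s = <-irrefl refl (<-≤-trans s le)
Nearer⇒¬Side false a b le s = <-irrefl refl (<-≤-trans s le)

nearest : ∀ {n} (Pr : Fin n → Set) → (∀ x → Dec (Pr x)) → (f : Fin n → ℕ) (h : Bool) →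
  ∀ x → Pr x → Σ (Fin n) λ q → Pr q × (∀ z → Pr z → Nearer h (f q) (f z))
nearest {suc n} Pr d f h x px with any? (λ y → d (suc y))
... | no none with x
...   | zero = zero , px , λ { zero _ → Nearer-refl h (f zero) ; (suc y) py → ⊥-elim (none (y , py)) }
...   | suc y = ⊥-elim (none (y , px))
nearest {suc n} Pr d f h x px | yes (y , py) with nearest (Pr ∘ suc) (d ∘ suc) (f ∘ suc) h y py
... | (q , pq , bq) with d zero
...   | no n0 = suc q , pq , λ { zero p0 → ⊥-elim (n0 p0) ; (suc z) pz → bq z pz }
...   | yes p0 with Nearer-total h (f zero) (f (suc q))
...     | inj₁ le = zero , p0 , λ { zero _ → Nearer-refl h (f zero) ; (suc z) pz → Nearer-trans h le (bq z pz) }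
...     | inj₂ le = suc q , pq , λ { zero _ → le ; (suc z) pz → bq z pz }

pos<top : ∀ {n} (x : Fin n) → pos x < suc n
pos<top x = s≤s (toℕ<n x)

pos>0 : ∀ {n} (x : Fin n) → 0 < pos x
pos>0 x = s≤s z≤n

pos-injective : ∀ {n} {x y : Fin n} → pos x ≡ pos y → x ≡ y
pos-injective e = toℕ-injective (NP.suc-injective e)

perm-injective : ∀ {n} (w : Permutation′ n) {x y} → w ⟨$⟩ʳ x ≡ w ⟨$⟩ʳ y → x ≡ y
perm-injective w = Injection.injective (↔⇒↣ w)

-- The
-- four squares incident to g are (CF h , RF v); in the occurrence the
-- square (CF h , RF v) is the product of the strip on side h of gx and the
-- strip on side v of gy.

module Relocation {n : ℕ} (w : Permutation′ n) (P : MeshPattern)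
                  (ι : Fin (size P) → Fin n) (occ : Occurrence w P ι) (i₀ : Fin (size P)) where
  k : ℕ
  k = size P
  p : Permutation′ k
  p = perm P
  R : Fin (suc k) → Fin (suc k) → Bool
  R = shade P
  top : ℕ
  top = suc n

  C V : Fin k → ℕ
  C = iPos w P ι
  V = vVal w P ι

  j₀ : Fin k
  j₀ = p ⟨$⟩ʳ i₀

  Oc Or : Bool → ℕ
  Oc = Out C top i₀
  Or = Out V top j₀
  gx gy : ℕ
  gx = C i₀
  gy = V j₀

  CF RF : Bool → Fin (suc k)
  CF = col P i₀
  RF = row P i₀

  Shaded : Fin (suc k) → Fin (suc k) → Set
  Shaded a b = R a b ≡ true

  InIncident : Bool → Bool → Fin n → Set
  InIncident h v z = Strip Oc h gx (pos z) × Strip Or v gy (pos (w ⟨$⟩ʳ z))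

  inIncident? : ∀ h v z → Dec (InIncident h v z)
  inIncident? h v z = strip? Oc h gx (pos z) ×-dec strip? Or v gy (pos (w ⟨$⟩ʳ z))

  -- Both families of lines are increasing: columns since ι is increasing,
  -- rows since ι is order isomorphic to p.
  C-increasing : StrictlyIncreasing C
  C-increasing s t lt = s≤s (proj₁ occ s t lt)

  V-increasing : StrictlyIncreasing V
  V-increasing c d lt = s≤s (Equivalence.from (proj₁ (proj₂ occ) (p ⟨$⟩ˡ c) (p ⟨$⟩ˡ d))
    (subst₂ (λ a b → toℕ a < toℕ b) (sym (inverseʳ p)) (sym (inverseʳ p)) lt))

  V∘p : ∀ b → V (p ⟨$⟩ʳ b) ≡ pos (w ⟨$⟩ʳ ι b)
  V∘p b = cong (λ t → pos (w ⟨$⟩ʳ ι t)) (inverseˡ p)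

  onColumn : ∀ z → pos z ≡ gx → z ≡ ι i₀
  onColumn z = pos-injective

  onRow : ∀ z → pos (w ⟨$⟩ʳ z) ≡ gy → z ≡ ι i₀
  onRow z e = perm-injective w (pos-injective (trans e (V∘p i₀)))

  sameRow : ∀ z → pos z ≡ gx → pos (w ⟨$⟩ʳ z) ≡ gy
  sameRow z e = trans (cong (λ t → pos (w ⟨$⟩ʳ t)) (onColumn z e)) (sym (V∘p i₀))

  offRow : ∀ z a → InSquare C top a (pos z) → pos (w ⟨$⟩ʳ z) ≢ gy
  offRow z a (l , u) e = line∉square top C-increasing a i₀
    (subst (λ t → lo C a < pos t) (onRow z e) l) (subst (λ t → pos t < hi C top a) (onRow z e) u)

  offColumn : ∀ z b → InSquare V top b (pos (w ⟨$⟩ʳ z)) → pos z ≢ gx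
  offColumn z b (l , u) e = line∉square top V-increasing b j₀
    (subst (lo V b <_) (sameRow z e) l) (subst (_< hi V top b) (sameRow z e) u)

  gxInside : Inside Oc gx
  gxInside = line-inside top C-increasing (λ t → pos<top (ι t)) (λ t → pos>0 (ι t)) i₀

  gyInside : Inside Or gy
  gyInside = line-inside top V-increasing (λ t → pos<top _) (λ t → pos>0 _) j₀

  colAdjacent : Adjacent i₀ CF
  colAdjacent = refl , refl

  rowAdjacent : Adjacent j₀ RF
  rowAdjacent = refl , refl

  emptyShaded : ∀ a b → Shaded a b → ∀ z → InSquare C top a (pos z) →
    InSquare V top b (pos (w ⟨$⟩ʳ z)) → ⊥
  emptyShaded a b r z (l₁ , l₂) (l₃ , l₄) = proj₂ (proj₂ occ) a b r z (l₁ , l₂ , l₃ , l₄)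

  -- Relocate g to a point q of the incident square (CF hq , RF vq).  The
  -- result is an occurrence provided
  --  * rowCond: along the rows of g, shading on the far side of q is matched
  --    by shading on q's side (columns away from g);
  --  * colCond: the same along the columns of g;
  --  * oppositeFree: the square of g opposite to q is not shaded;
  --  * incidentCond: a point near q in a shaded square incident to q lies in
  --    a shaded square incident to g.
  module Relocate (q : Fin n) (hq vq : Bool) (qIn : InIncident hq vq q)
    (rowCond : ∀ x → x ≢ CF false → x ≢ CF true → Shaded x (RF (not vq)) → Shaded x (RF vq))
    (colCond : ∀ y → y ≢ RF false → y ≢ RF true → Shaded (CF (not hq)) y → Shaded (CF hq) y)
    (oppositeFree : ¬ Shaded (CF (not hq)) (RF (not vq)))
    (incidentCond : ∀ z h₁ v₁ h₀ v₀ → Strip Oc h₁ (pos q) (pos z) →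
      Strip Or v₁ (pos (w ⟨$⟩ʳ q)) (pos (w ⟨$⟩ʳ z)) → InIncident h₀ v₀ z →
      Shaded (CF h₁) (RF v₁) → Shaded (CF h₀) (RF v₀)) where

    ι' : Fin k → Fin n
    ι' = updateAt ι i₀ (const q)

    ι'-at : ι' i₀ ≡ q
    ι'-at = updateAt-updates i₀ ι

    ι'-else : ∀ i → i ≢ i₀ → ι' i ≡ ι i
    ι'-else i ne = updateAt-minimal i i₀ ι ne

    qx qy : ℕ
    qx = pos q
    qy = pos (w ⟨$⟩ʳ q)

    C' V' : Fin k → ℕ
    C' = iPos w P ι'
    V' = vVal w P ι'

    C'-else : ∀ i → i ≢ i₀ → C' i ≡ C i
    C'-else i ne = cong pos (ι'-else i ne)

    V'-else : ∀ c → c ≢ j₀ → V' c ≡ V c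
    V'-else c ne = cong (λ t → pos (w ⟨$⟩ʳ t))
      (ι'-else (p ⟨$⟩ˡ c) (λ e → ne (trans (sym (inverseʳ p)) (cong (p ⟨$⟩ʳ_) e))))

    C'-at : C' i₀ ≡ qx
    C'-at = cong pos ι'-at

    V'-at : V' j₀ ≡ qy
    V'-at = trans (cong (λ t → pos (w ⟨$⟩ʳ ι' t)) (inverseˡ p)) (cong (λ t → pos (w ⟨$⟩ʳ t)) ι'-at)

    qxInside : Inside Oc qx
    qxInside = stripInside Oc hq gx qx gxInside (proj₁ qIn)

    qyInside : Inside Or qy
    qyInside = stripInside Or vq gy qy gyInside (proj₂ qIn)

    -- q lies strictly between the columns of the neighbours of g …
    increasing' : Increasing w P ι'
    increasing' a b lt with a ≟ i₀ | b ≟ i₀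
    ... | yes refl | yes refl = ⊥-elim (<-irrefl refl lt)
    ... | yes refl | no b≢ rewrite ι'-at | ι'-else b b≢ =
      ≤-pred (<-≤-trans (proj₂ qxInside) (hi≤line top C-increasing (suc i₀) b lt))
    ... | no a≢ | yes refl rewrite ι'-at | ι'-else a a≢ =
      ≤-pred (≤-<-trans (line≤lo C-increasing (inject₁ i₀) a (subst (toℕ a <_) (sym (toℕ-inject₁ i₀)) lt))
                        (proj₁ qxInside))
    ... | no a≢ | no b≢ rewrite ι'-else a a≢ | ι'-else b b≢ = proj₁ occ a b lt

    compareQ : ∀ b → b ≢ i₀ →
      (j₀ F.< p ⟨$⟩ʳ b × qy < pos (w ⟨$⟩ʳ ι b)) ⊎ (p ⟨$⟩ʳ b F.< j₀ × pos (w ⟨$⟩ʳ ι b) < qy)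
    compareQ b b≢ with <-cmp (toℕ j₀) (toℕ (p ⟨$⟩ʳ b))
    ... | tri< lt _ _ = inj₁ (lt , subst (qy <_) (V∘p b)
          (<-≤-trans (proj₂ qyInside) (hi≤line top V-increasing (suc j₀) (p ⟨$⟩ʳ b) lt)))
    ... | tri≈ _ e _ = ⊥-elim (b≢ (sym (perm-injective p (toℕ-injective e))))
    ... | tri> _ _ gt = inj₂ (gt , subst (_< qy) (V∘p b)
          (≤-<-trans (line≤lo V-increasing (inject₁ j₀) (p ⟨$⟩ʳ b)
                       (subst (toℕ (p ⟨$⟩ʳ b) <_) (sym (toℕ-inject₁ j₀)) gt))
                     (proj₁ qyInside)))

    orderIso' : OrderIso w P ι'
    orderIso' a b with a ≟ i₀ | b ≟ i₀
    ... | yes refl | yes refl = mk⇔ (λ x → ⊥-elim (<-irrefl refl x)) (λ x → ⊥-elim (<-irrefl refl x))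
    ... | yes refl | no b≢ rewrite ι'-at | ι'-else b b≢ with compareQ b b≢
    ...   | inj₁ (l₁ , l₂) = mk⇔ (λ _ → l₁) (λ _ → ≤-pred l₂)
    ...   | inj₂ (l₁ , l₂) = mk⇔ (λ x → ⊥-elim (<-asym (s≤s x) l₂)) (λ x → ⊥-elim (<-asym x l₁))
    orderIso' a b | no a≢ | yes refl rewrite ι'-at | ι'-else a a≢ with compareQ a a≢
    ...   | inj₁ (l₁ , l₂) = mk⇔ (λ x → ⊥-elim (<-asym (s≤s x) l₂)) (λ x → ⊥-elim (<-asym x l₁))
    ...   | inj₂ (l₁ , l₂) = mk⇔ (λ _ → l₁) (λ _ → ≤-pred l₂)
    orderIso' a b | no a≢ | no b≢ rewrite ι'-else a a≢ | ι'-else b b≢ = proj₁ (proj₂ occ) a b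

    -- A point in an old column square a and in the row strip around q lies
    -- in an old square (a , RF v₀); if v₀ differs from v₁, rowCond applies.
    rowSquare : ∀ a v₁ → Shaded a (RF v₁) → ∀ z → a ≢ CF false → a ≢ CF true →
      InSquare C top a (pos z) → Strip Or v₁ qy (pos (w ⟨$⟩ʳ z)) → ⊥
    rowSquare a v₁ r z a≢₀ a≢₁ zCol zRow with sideOf _ gy (offRow z a zCol)
    ... | (v₀ , zSide) = emptyShaded a (RF v₀) shaded z zCol
      (Equivalence.to (strip⇔square V top j₀ RF rowAdjacent v₀ _)
        (strip-beyond Or vq v₁ v₀ gy qy _ gyInside (proj₂ qIn) zRow zSide))
      where
      shaded : Shaded a (RF v₀)
      shaded with side-beyond vq v₁ v₀ (proj₁ (proj₂ qIn)) (proj₁ zRow) zSide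
      ... | inj₁ e = subst (λ t → Shaded a (RF t)) (sym e) r
      ... | inj₂ (e₀ , e₁) =
        subst (λ t → Shaded a (RF t)) (sym e₀)
          (rowCond a a≢₀ a≢₁ (subst (λ t → Shaded a (RF t)) (sym e₁) r))

    colSquare : ∀ b h₁ → Shaded (CF h₁) b → ∀ z → b ≢ RF false → b ≢ RF true →
      InSquare V top b (pos (w ⟨$⟩ʳ z)) → Strip Oc h₁ qx (pos z) → ⊥
    colSquare b h₁ r z b≢₀ b≢₁ zRow zCol with sideOf _ gx (offColumn z b zRow)
    ... | (h₀ , zSide) = emptyShaded (CF h₀) b shaded z
      (Equivalence.to (strip⇔square C top i₀ CF colAdjacent h₀ _)
        (strip-beyond Oc hq h₁ h₀ gx qx _ gxInside (proj₁ qIn) zCol zSide)) zRow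
      where
      shaded : Shaded (CF h₀) b
      shaded with side-beyond hq h₁ h₀ (proj₁ (proj₁ qIn)) (proj₁ zCol) zSide
      ... | inj₁ e = subst (λ t → Shaded (CF t) b) (sym e) r
      ... | inj₂ (e₀ , e₁) =
        subst (λ t → Shaded (CF t) b) (sym e₀)
          (colCond b b≢₀ b≢₁ (subst (λ t → Shaded (CF t) b) (sym e₁) r))

    -- A point in a square incident to q is either g itself (then the square
    -- is the one opposite to q) or lies in a square incident to g.
    incidentSquare : ∀ h₁ v₁ → Shaded (CF h₁) (RF v₁) → ∀ z →
      Strip Oc h₁ qx (pos z) → Strip Or v₁ qy (pos (w ⟨$⟩ʳ z)) → ⊥
    incidentSquare h₁ v₁ r z zCol zRow with pos z N.≟ gx
    ... | yes e = oppositeFree (subst₂ (λ h v → Shaded (CF h) (RF v)) (sym hq-opp) (sym vq-opp) r)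
      where
      hq-opp : not hq ≡ h₁
      hq-opp = opposite-sides hq h₁ (proj₁ (proj₁ qIn)) (subst (λ t → Side h₁ t qx) e (proj₁ zCol))
      vq-opp : not vq ≡ v₁
      vq-opp = opposite-sides vq v₁ (proj₁ (proj₂ qIn)) (subst (λ t → Side v₁ t qy) (sameRow z e) (proj₁ zRow))
    ... | no zx≢gx with sideOf _ gx zx≢gx | sideOf _ gy (zx≢gx ∘ cong pos ∘ onRow z)
    ...   | (h₀ , zxSide) | (v₀ , zySide) =
      emptyShaded (CF h₀) (RF v₀) (incidentCond z h₁ v₁ h₀ v₀ zCol zRow zIn r) z
      (Equivalence.to (strip⇔square C top i₀ CF colAdjacent h₀ _) (proj₁ zIn))
      (Equivalence.to (strip⇔square V top j₀ RF rowAdjacent v₀ _) (proj₂ zIn))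
      where
      zIn : InIncident h₀ v₀ z
      zIn = strip-beyond Oc hq h₁ h₀ gx qx _ gxInside (proj₁ qIn) zCol zxSide
          , strip-beyond Or vq v₁ v₀ gy qy _ gyInside (proj₂ qIn) zRow zySide

    -- Every shaded square of the new occurrence is empty: classify it by
    -- whether its column and row are adjacent to the moved lines.
    empty' : ∀ a b → Shaded a b → EmptyBox w P ι' a b
    empty' a b r z (l₁ , l₂ , l₃ , l₄)
      with movedLine-square C C' top i₀ CF colAdjacent C'-else a (pos z) (l₁ , l₂)
         | movedLine-square V V' top j₀ RF rowAdjacent V'-else b (pos (w ⟨$⟩ʳ z)) (l₃ , l₄)
    ... | inj₂ (_ , _ , zCol) | inj₂ (_ , _ , zRow) = emptyShaded a b r z zCol zRow
    ... | inj₂ (a≢₀ , a≢₁ , zCol) | inj₁ (v₁ , refl , zRow) =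
      rowSquare a v₁ r z a≢₀ a≢₁ zCol (subst (λ t → Strip Or v₁ t (pos (w ⟨$⟩ʳ z))) V'-at zRow)
    ... | inj₁ (h₁ , refl , zCol) | inj₂ (b≢₀ , b≢₁ , zRow) =
      colSquare b h₁ r z b≢₀ b≢₁ zRow (subst (λ t → Strip Oc h₁ t (pos z)) C'-at zCol)
    ... | inj₁ (h₁ , refl , zCol) | inj₁ (v₁ , refl , zRow) =
      incidentSquare h₁ v₁ r z (subst (λ t → Strip Oc h₁ t (pos z)) C'-at zCol)
                               (subst (λ t → Strip Or v₁ t (pos (w ⟨$⟩ʳ z))) V'-at zRow)

    relocated : Occurrence w P ι'
    relocated = increasing' , orderIso' , empty'

module Descent (P : MeshPattern) (G : Fin (size P) → Bool) (s : Fin (size P) → Shading)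
               (shadeable : ∀ i → G i ≡ true → Shadeable P i (s i)) {n : ℕ} (w : Permutation′ n) where
  k : ℕ
  k = size P
  R : Fin (suc k) → Fin (suc k) → Bool
  R = shade P
  P' : MeshPattern
  P' = addShading P G s
  top : ℕ
  top = suc n

  towards : Bool → ℕ → ℕ
  towards true x = top ∸ x
  towards false x = x

  towards-< : ∀ h {x' x} → Side h x' x → x' < top → towards h x' < towards h x
  towards-< true s b = NP.∸-monoʳ-< s (<⇒≤ b)
  towards-< false s b = s

  distance : Shading → Fin n → ℕ
  distance (single h v) z = towards h (pos z) + towards v (pos (w ⟨$⟩ʳ z))
  distance (vertical h) z = towards h (pos z)
  distance (horizontal v) z = towards v (pos (w ⟨$⟩ʳ z))

  μ : (Fin k → Fin n) → ℕ
  μ ι = sumFin (λ i → if G i then distance (s i) (ι i) else 0)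

  InBox : (Fin k → Fin n) → Fin (suc k) → Fin (suc k) → Fin n → Set
  InBox ι a b z = InSquare (iPos w P ι) top a (pos z) × InSquare (vVal w P ι) top b (pos (w ⟨$⟩ʳ z))

  inBox? : ∀ ι a b z → Dec (InBox ι a b z)
  inBox? ι a b z = ((_ <? _) ×-dec (_ <? _)) ×-dec ((_ <? _) ×-dec (_ <? _))

  Violated : (Fin k → Fin n) → Set
  Violated ι = ∃ λ i → ∃ λ a → ∃ λ b → ∃ λ z →
    (G i ≡ true × squares P i (s i) a b ≡ true) × InBox ι a b z

  violated? : ∀ ι → Dec (Violated ι)
  violated? ι = any? λ i → any? λ a → any? λ b → any? λ z →
    (BP._≟_ (G i) true ×-dec BP._≟_ (squares P i (s i) a b) true) ×-dec inBox? ι a b z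

  Improvement : (Fin k → Fin n) → Set
  Improvement ι = Σ (Fin k → Fin n) λ ι' → Occurrence w P ι' × μ ι' < μ ι

  module AtPoint (ι : Fin k → Fin n) (occ : Occurrence w P ι) (i₀ : Fin k) (gi : G i₀ ≡ true) where
    open Relocation w P ι occ i₀ hiding (k; R; top)

    decrease : ∀ q → distance (s i₀) q < distance (s i₀) (ι i₀) → μ (updateAt ι i₀ (const q)) < μ ι
    decrease q lt = sumFin-< _ _ i₀
      (λ i ne → cong (λ t → if G i then distance (s i) t else 0) (updateAt-minimal i i₀ ι ne))
      (subst (λ t → (if G i₀ then distance (s i₀) t else 0) < (if G i₀ then distance (s i₀) (ι i₀) else 0))
        (sym (updateAt-updates i₀ ι)) (weighted lt))
      where
      weighted : ∀ {x y} → x < y → (if G i₀ then x else 0) < (if G i₀ then y else 0)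
      weighted lt rewrite gi = lt

    improvement : ∀ σ → s i₀ ≡ σ → ∀ q → distance σ q < distance σ (ι i₀) →
      Occurrence w P (updateAt ι i₀ (const q)) → Improvement ι
    improvement σ eσ q lt occ' = updateAt ι i₀ (const q) , occ'
      , decrease q (subst (λ τ → distance τ q < distance τ (ι i₀)) (sym eσ) lt)

    column-closer : ∀ {h v} q → InIncident h v q → towards h (pos q) < towards h (pos (ι i₀))
    column-closer {h} q qIn = towards-< h (proj₁ (proj₁ qIn)) (pos<top q)

    row-closer : ∀ {h v} q → InIncident h v q →
      towards v (pos (w ⟨$⟩ʳ q)) < towards v (pos (w ⟨$⟩ʳ ι i₀))
    row-closer {v = v} q qIn = subst (λ t → towards v (pos (w ⟨$⟩ʳ q)) < towards v t) (V∘p i₀)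
      (towards-< v (proj₁ (proj₂ qIn)) (pos<top _))

    boxIncident : ∀ h v a b z → a ≡ col P i₀ h → b ≡ row P i₀ v → InBox ι a b z → InIncident h v z
    boxIncident h v a b z refl refl (zCol , zRow) =
      Equivalence.from (strip⇔square C top i₀ CF colAdjacent h _) zCol
      , Equivalence.from (strip⇔square V top j₀ RF rowAdjacent v _) zRow

    rows-agree :
      (∀ x → (Shaded x (RF false) → Shaded x (RF true)) × (Shaded x (RF true) → Shaded x (RF false))) →
      ∀ v x → Shaded x (RF (not v)) → Shaded x (RF v)
    rows-agree both false x = proj₂ (both x)
    rows-agree both true x = proj₁ (both x)

    columns-agree :
      (∀ y → (Shaded (CF false) y → Shaded (CF true) y) × (Shaded (CF true) y → Shaded (CF false) y)) →
      ∀ h y → Shaded (CF (not h)) y → Shaded (CF h) y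
    columns-agree both false y = proj₂ (both y)
    columns-agree both true y = proj₁ (both y)

    -- Vertical pair in column h: g moves to any point z of the square;
    -- no incident square is shaded, and both rows of g are shaded alike.
    vertical-step : ∀ h v → s i₀ ≡ vertical h → ShadeableVertical P i₀ h → ∀ z → InIncident h v z →
      Improvement ι
    vertical-step h v eσ (none , rows , cols) z zIn = improvement (vertical h) eσ z (column-closer z zIn)
      (Relocate.relocated z h v zIn (λ x _ _ → rows-agree rows v x) (λ y _ _ → cols y) (none (not h) (not v))
        (λ _ h₁ v₁ _ _ _ _ _ r → ⊥-elim (none h₁ v₁ r)))

    horizontal-step : ∀ v h → s i₀ ≡ horizontal v → ShadeableHorizontal P i₀ v → ∀ z → InIncident h v z →
      Improvement ι
    horizontal-step v h eσ (none , cols , rows) z zIn = improvement (horizontal v) eσ z (row-closer z zIn)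
      (Relocate.relocated z h v zIn (λ x _ _ → rows x) (λ y _ _ → columns-agree cols h y) (none (not h) (not v))
        (λ _ h₁ v₁ _ _ _ _ _ r → ⊥-elim (none h₁ v₁ r)))

    -- If its horizontal neighbour (not h , v)
    -- is shaded, q is the point of the square nearest to g horizontally;
    -- otherwise q is the point nearest to g vertically.
    module Single (h v : Bool) (sh : ShadeableSingle P i₀ h v) where
      notShaded : ¬ Shaded (CF h) (RF v)
      notShaded = proj₁ sh
      oppositeFree : ¬ Shaded (CF (not h)) (RF (not v))
      oppositeFree = proj₁ (proj₂ sh)
      notBoth : ¬ (Shaded (CF h) (RF (not v)) × Shaded (CF (not h)) (RF v))
      notBoth = proj₁ (proj₂ (proj₂ sh))
      rowCond : ∀ x → x ≢ CF false → x ≢ CF true → Shaded x (RF (not v)) → Shaded x (RF v)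
      rowCond = proj₁ (proj₂ (proj₂ (proj₂ sh)))
      colCond : ∀ y → y ≢ RF false → y ≢ RF true → Shaded (CF (not h)) y → Shaded (CF h) y
      colCond = proj₂ (proj₂ (proj₂ (proj₂ sh)))

      Nearest : Fin n → Set
      Nearest q = (Shaded (CF (not h)) (RF v) × (∀ z → InIncident h v z → ¬ Side (not h) (pos z) (pos q)))
                ⊎ (¬ Shaded (CF (not h)) (RF v)
                   × (∀ z → InIncident h v z → ¬ Side (not v) (pos (w ⟨$⟩ʳ z)) (pos (w ⟨$⟩ʳ q))))

      row-beyond : ∀ q → InIncident h v q → ∀ {z} h₀ v₀ → Side v (pos (w ⟨$⟩ʳ z)) (pos (w ⟨$⟩ʳ q)) →
        InIncident h₀ v₀ z → v₀ ≡ v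
      row-beyond q qIn h₀ v₀ zq zIn =
        [ id , proj₁ ] (side-beyond v v v₀ (proj₁ (proj₂ qIn)) zq (proj₁ (proj₂ zIn)))

      column-beyond : ∀ q → InIncident h v q → ∀ {z} h₀ v₀ → Side h (pos z) (pos q) →
        InIncident h₀ v₀ z → h₀ ≡ h
      column-beyond q qIn h₀ v₀ zq zIn =
        [ id , proj₁ ] (side-beyond h h h₀ (proj₁ (proj₁ qIn)) zq (proj₁ (proj₁ zIn)))

      -- The squares incident to q are the four (h₁ , v₁).  (h , v) and the
      -- opposite square are unshaded.  For a horizontal neighbour (not h , v)
      -- a point z near q lies in (not h , v) at g, or in (h , v) at g between
      -- g and q: impossible when q is horizontally nearest, and otherwise
      -- (not h , v) is unshaded.  The vertical neighbour is symmetric, using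
      -- that the two neighbours are not both shaded.
      incident : ∀ q → InIncident h v q → Nearest q →
        ∀ z h₁ v₁ h₀ v₀ → Strip Oc h₁ (pos q) (pos z) → Strip Or v₁ (pos (w ⟨$⟩ʳ q)) (pos (w ⟨$⟩ʳ z)) →
        InIncident h₀ v₀ z → Shaded (CF h₁) (RF v₁) → Shaded (CF h₀) (RF v₀)
      incident q qIn nearest z h₁ v₁ h₀ v₀ zCol zRow zIn r with bool-cases h h₁ | bool-cases v v₁
      ... | inj₁ refl | inj₁ refl = ⊥-elim (notShaded r)
      ... | inj₂ refl | inj₂ refl = ⊥-elim (oppositeFree r)
      ... | inj₂ refl | inj₁ refl with bool-cases h h₀ | nearest
      ...   | inj₂ refl | _ = subst (λ t → Shaded (CF (not h)) (RF t)) (sym v₀≡v) r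
        where
        v₀≡v : v₀ ≡ v
        v₀≡v = row-beyond q qIn h₀ v₀ (proj₁ zRow) zIn
      ...   | inj₁ refl | inj₁ (_ , noneBetween) =
        ⊥-elim (noneBetween z (subst (λ t → InIncident h t z) v₀≡v zIn) (proj₁ zCol))
        where
        v₀≡v : v₀ ≡ v
        v₀≡v = row-beyond q qIn h₀ v₀ (proj₁ zRow) zIn
      ...   | inj₁ refl | inj₂ (notNeighbour , _) = ⊥-elim (notNeighbour r)
      incident q qIn nearest z h₁ v₁ h₀ v₀ zCol zRow zIn r | inj₁ refl | inj₂ refl with bool-cases v v₀ | nearest
      ...   | inj₂ refl | _ = subst (λ t → Shaded (CF t) (RF (not v))) (sym h₀≡h) r
        where
        h₀≡h : h₀ ≡ h
        h₀≡h = column-beyond q qIn h₀ v₀ (proj₁ zCol) zIn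
      ...   | inj₁ refl | inj₁ (neighbour , _) = ⊥-elim (notBoth (r , neighbour))
      ...   | inj₁ refl | inj₂ (_ , noneBetween) =
        ⊥-elim (noneBetween z (subst (λ t → InIncident t v z) h₀≡h zIn) (proj₁ zRow))
        where
        h₀≡h : h₀ ≡ h
        h₀≡h = column-beyond q qIn h₀ v₀ (proj₁ zCol) zIn

      nearestPoint : ∀ z → InIncident h v z → Σ (Fin n) λ q → InIncident h v q × Nearest q
      nearestPoint z zIn with BP._≟_ (R (CF (not h)) (RF v)) true
      ... | yes neighbour with nearest (InIncident h v) (inIncident? h v) pos h z zIn
      ...   | (q , qIn , best) = q , qIn , inj₁ (neighbour , λ z' z'In → Nearer⇒¬Side h _ _ (best z' z'In))
      nearestPoint z zIn | no notNeighbour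
        with nearest (InIncident h v) (inIncident? h v) (λ t → pos (w ⟨$⟩ʳ t)) v z zIn
      ...   | (q , qIn , best) = q , qIn , inj₂ (notNeighbour , λ z' z'In → Nearer⇒¬Side v _ _ (best z' z'In))

      step : s i₀ ≡ single h v → ∀ z → InIncident h v z → Improvement ι
      step eσ z zIn with nearestPoint z zIn
      ... | (q , qIn , nearestQ) = improvement (single h v) eσ q
        (NP.+-mono-< (column-closer q qIn) (row-closer q qIn))
        (Relocate.relocated q h v qIn rowCond colCond oppositeFree (incident q qIn nearestQ))

    improve : ∀ a b z → squares P i₀ (s i₀) a b ≡ true → InBox ι a b z → Improvement ι
    improve a b z sq box with s i₀ in eσ | shadeable i₀ gi
    ... | single h v | sh with ∧-split {⌊ a ≟ col P i₀ h ⌋} sq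
    ...   | (ea , eb) = Single.step h v sh eσ z (boxIncident h v a b z (dec-true _ ea) (dec-true _ eb) box)
    improve a b z sq box | vertical h | sh with ∧-split {⌊ a ≟ col P i₀ h ⌋} sq
    ...   | (ea , eb) with ∨-split {⌊ b ≟ row P i₀ false ⌋} eb
    ...     | inj₁ eb' =
      vertical-step h false eσ sh z (boxIncident h false a b z (dec-true _ ea) (dec-true _ eb') box)
    ...     | inj₂ eb' =
      vertical-step h true eσ sh z (boxIncident h true a b z (dec-true _ ea) (dec-true _ eb') box)
    improve a b z sq box | horizontal v | sh
      with ∧-split {⌊ a ≟ col P i₀ false ⌋ ∨ ⌊ a ≟ col P i₀ true ⌋} sq
    ...   | (ea , eb) with ∨-split {⌊ a ≟ col P i₀ false ⌋} ea
    ...     | inj₁ ea' =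
      horizontal-step v false eσ sh z (boxIncident false v a b z (dec-true _ ea') (dec-true _ eb) box)
    ...     | inj₂ ea' =
      horizontal-step v true eσ sh z (boxIncident true v a b z (dec-true _ ea') (dec-true _ eb) box)

  step : ∀ ι → Occurrence w P ι → Occurrence w P' ι ⊎ Improvement ι
  step ι occ with violated? ι
  ... | yes (i , a , b , z , (gi , sq) , box) = inj₂ (AtPoint.improve ι occ i gi a b z sq box)
  ... | no clean = inj₁ (proj₁ occ , proj₁ (proj₂ occ) , empty)
    where
    empty : ∀ a b → (R a b ∨ unionShading P G s a b) ≡ true → EmptyBox w P' ι a b
    empty a b e with ∨-split {R a b} e
    ... | inj₁ r = proj₂ (proj₂ occ) a b r
    ... | inj₂ u with anyFin-true _ u
    ...   | (i , gs) = λ z (l₁ , l₂ , l₃ , l₄) →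
      clean (i , a , b , z , ∧-split {G i} gs , (l₁ , l₂) , (l₃ , l₄))

  descend : ∀ ι → Acc _<_ (μ ι) → Occurrence w P ι → Contains w P'
  descend ι (acc rec) occ with step ι occ
  ... | inj₁ occ' = ι , occ'
  ... | inj₂ (ι' , occ' , smaller) = descend ι' (rec smaller) occ'

  forget : ∀ ι → Occurrence w P' ι → Occurrence w P ι
  forget ι (inc , iso , empty) = inc , iso , λ a b r → empty a b (cong (_∨ unionShading P G s a b) r)

lemma7p6 : (P : MeshPattern) (G : Fin (size P) → Bool) (s : Fin (size P) → Shading) →
    (∀ i → G i ≡ true → Shadeable P i (s i)) →
    P ≍ addShading P G s
lemma7p6 P G s shadeable n w = mk⇔
  (λ avoidsP (ι , occ') → avoidsP (ι , forget ι occ'))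
  (λ avoidsP' (ι , occ) → avoidsP' (descend ι (<-wellFounded (μ ι)) occ))
  where open Descent P G s shadeable w
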